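{- Let $m$ and $n$ be positive integers with $n$ odd, and let $q=2^m$. Let $d_1,d_2,\ldots,d_s$ be distinct positive integers with $d_1\mid d_2\mid\cdots\mid d_s\mid n$, set $d_0=1$, and let $c_0\in\mathbb{F}_q$ and $c_i\in\mathbb{F}_{q^{d_i}}$ for $1\le i\le s$. Put $c=\sum_{j=0}^{s}c_j$. Then for every $\tilde c\in\mathbb{F}_q\setminus\{0,1\}$, the polynomial \[F(x)=x\left(\sum_{i=0}^{s}c_i\,\mathrm{tr}_{d_im}^{nm}(x)+cx\right)+\tilde c x\] is a complete permutation polynomial over $\mathbb{F}_{q^n}$.
   Context: A polynomial $f\in\mathbb{F}_Q[x]$ is a complete permutation polynomial over $\mathbb{F}_Q$ if both $f(x)$ and $f(x)+x$ induce bijections of $\mathbb{F}_Q$. For positive integers $s'\mid r$, $\mathrm{tr}_{s'}^r$ denotes the relative trace from $\mathbb{F}_{2^r}$ to $\mathbb{F}_{2^{s'}}$, $\mathrm{tr}_{s'}^r(x)=\sum_{i=0}^{r/s'-1}x^{2^{s'i}}$. -}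

module Defs where

open import Level using (0ℓ)
open import Data.Nat using (ℕ; zero; suc; _/_)
import Data.Nat as ℕ
open import Data.Fin using (Fin)
import Data.Fin as Fin
open import Data.Product using (∃)
open import Function.Bundles using (_↔_)
open import Function.Definitions using (Bijective)
open import Relation.Binary.PropositionalEquality using (_≡_; _≢_)
open import Algebra.Core using (Op₁; Op₂)
open import Algebra.Structures using (IsCommutativeRing)

IsOdd : ℕ → Set
IsOdd n = ∃ λ k → n ≡ suc (2 ℕ.* k)

record GF2 (r : ℕ) : Set₁ where
  infixl 6 _+_
  infixl 7 _*_
  field
    Carrier : Set
    _+_ _*_ : Op₂ Carrier
    -_      : Op₁ Carrier
    0# 1#   : Carrier
    isCommutativeRing : IsCommutativeRing _≡_ _+_ _*_ -_ 0# 1#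
    0≢1     : 0# ≢ 1#
    inverse : ∀ x → x ≢ 0# → ∃ λ y → x * y ≡ 1#
    card    : Carrier ↔ Fin (2 ℕ.^ r)

  infixr 8 _^_
  _^_ : Carrier → ℕ → Carrier
  x ^ zero  = 1#
  x ^ suc k = x * (x ^ k)

  Σ< : ℕ → (ℕ → Carrier) → Carrier
  Σ< zero    f = 0#
  Σ< (suc k) f = Σ< k f + f k

  ΣF : (k : ℕ) → (Fin k → Carrier) → Carrier
  ΣF zero    f = 0#
  ΣF (suc k) f = f Fin.zero + ΣF k (λ i → f (Fin.suc i))

  -- total division: a ÷ 0 = 0 (only used with b ∣ a, b > 0)
  _÷_ : ℕ → ℕ → ℕ
  a ÷ zero  = zero
  a ÷ suc b = a / suc b

  tr : (s r' : ℕ) → Carrier → Carrier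
  tr s r' x = Σ< (r' ÷ s) (λ i → x ^ (2 ℕ.^ (s ℕ.* i)))

  -- membership in the subfield F_{2^k}  (elements fixed by x ↦ x^{2^k})
  In : ℕ → Carrier → Set
  In k a = a ^ (2 ℕ.^ k) ≡ a

  IsPermutation : (Carrier → Carrier) → Set
  IsPermutation f = Bijective _≡_ _≡_ f

  IsCompletePermutation : (Carrier → Carrier) → Set
  IsCompletePermutation f = IsPermutation f Data.Product.× IsPermutation (λ x → f x + x)
    where import Data.Product

{-# OPTIONS --safe #-}
module Submission where

-- Write F(x) = x (S(x) + C x) + c x, where S(x) = Σ aᵢ trᵢ(x) over a chain of
-- odd-degree subfields F_{2^{e₀}} ⊆ … ⊆ F_{2^{e_k}} and C = Σ aᵢ. Let T be the
-- trace onto the largest subfield F_{2^{e_k}}. Because all degrees are odd,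
-- trᵢ ∘ T = trᵢ, so S(x) only depends on T(x), and T ∘ F = F' ∘ T where F' is
-- the same map for the shorter chain; by induction F' is injective. Hence
-- F(x) = F(y) forces T(x) = T(y), and then in characteristic 2
-- F(x) + F(y) = z (S(x) + c + C z) with z = x + y. If z ≠ 0, applying T to the
-- second factor gives S(x) + c = 0 and C = 0, so F'(T x) = 0 = F'(0), whence
-- T(x) = 0, S(x) = 0 and c = 0. Both F and F(x) + x have this shape, with
-- c = c̃ and c = c̃ + 1, which are nonzero.

open import Defs
open import Level using (0ℓ)
open import Data.Nat using (ℕ; zero; suc; _≤_)
import Data.Nat as ℕ
import Data.Nat.Properties as ℕₚ
open import Data.Nat.Divisibility using (_∣_; divides; ∣-refl; n∣m*n; *-monoˡ-∣)
open import Data.Nat.DivMod using (_%_; m*n/n≡m; m*n%n≡0; [m+kn]%n≡m%n)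
open import Data.Fin using (Fin) renaming (_≤_ to _≤ᶠ_)
import Data.Fin as Fin
import Data.Fin.Properties as Finₚ
open import Data.Fin.Permutation using (Permutation; permutation)
open import Data.Vec.Functional using (_∷_)
open import Data.Bool using (Bool; true; false; _xor_; _∧_)
open import Data.Maybe using (Maybe; just; nothing)
open import Data.Product using (∃; _,_)
open import Data.Sum using (_⊎_; inj₁; inj₂)
open import Data.Empty using (⊥-elim)
open import Relation.Nullary using (Dec; yes; no)
open import Function.Base using (_∘_; id)
open import Function.Bundles using (_↔_; Inverse; Injection)
open import Function.Properties.Inverse using (↔⇒↣)
open import Function.Definitions using (Injective)
open import Relation.Binary.PropositionalEquality
open import Algebra.Bundles using (CommutativeMonoid; CommutativeRing; RawRing)
open import Algebra.Structures using (IsCommutativeRing)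
import Algebra.Properties.CommutativeMonoid.Sum as MonoidSum
import Algebra.Solver.Ring.AlmostCommutativeRing as ACR

Fin-injective⇒surjective : ∀ {n} (f : Fin n → Fin n) → Injective _≡_ _≡_ f →
                           ∀ y → ∃ λ x → f x ≡ y
Fin-injective⇒surjective f f-inj y with Finₚ.any? (λ x → f x Fin.≟ y)
... | yes hit = hit
Fin-injective⇒surjective {zero} f f-inj () | no _
Fin-injective⇒surjective {suc n} f f-inj y | no miss
  with i , j , i<j , gi≡gj ← Finₚ.pigeonhole (ℕₚ.n<1+n n)
                               (λ x → Fin.punchOut {i = y} {j = f x} (miss ∘ (x ,_) ∘ sym))
  = ⊥-elim (Finₚ.<-irrefl (f-inj (Finₚ.punchOut-injective
      (miss ∘ (i ,_) ∘ sym) (miss ∘ (j ,_) ∘ sym) gi≡gj)) i<j)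

even-or-odd : ∀ n → (∃ λ t → n ≡ 2 ℕ.* t) ⊎ IsOdd n
even-or-odd zero = inj₁ (0 , refl)
even-or-odd (suc n) with even-or-odd n
... | inj₁ (t , n≡2t) = inj₂ (t , cong suc n≡2t)
... | inj₂ (t , n≡1+2t) = inj₁ (suc t , trans (cong suc n≡1+2t) (sym (ℕₚ.*-suc 2 t)))

even≢odd : ∀ a b → 2 ℕ.* a ≢ suc (2 ℕ.* b)
even≢odd a b 2a≡1+2b with
  trans (sym (trans (cong (_% 2) (ℕₚ.*-comm 2 a)) (m*n%n≡0 a 2)))
        (trans (cong (_% 2) 2a≡1+2b)
               (trans (cong (λ t → (1 ℕ.+ t) % 2) (ℕₚ.*-comm 2 b)) ([m+kn]%n≡m%n 1 b 2)))
... | ()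

IsOdd-*ˡ : ∀ q d → IsOdd (q ℕ.* d) → IsOdd q
IsOdd-*ˡ q d (k , qd≡1+2k) with even-or-odd q
... | inj₂ q-odd = q-odd
... | inj₁ (t , refl) = ⊥-elim (even≢odd (t ℕ.* d) k (trans (sym (ℕₚ.*-assoc 2 t d)) qd≡1+2k))

module FiniteSum {A : Set} {Q : ℕ} (enum : A ↔ Fin Q) {c ℓ} (M : CommutativeMonoid c ℓ) where
  open CommutativeMonoid M using (Carrier; _≈_)
  private module M = CommutativeMonoid M
  open Inverse enum using (to; from; strictlyInverseˡ; strictlyInverseʳ)
  open MonoidSum M using (sum; sum-permute; sum-cong-≗)

  ∑ : (A → Carrier) → Carrier
  ∑ f = sum (f ∘ from)

  ∑-reindex : ∀ (f : A → Carrier) (h h⁻¹ : A → A) →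
              (∀ x → h (h⁻¹ x) ≡ x) → (∀ x → h⁻¹ (h x) ≡ x) → ∑ (f ∘ h) ≈ ∑ f
  ∑-reindex f h h⁻¹ h∘h⁻¹ h⁻¹∘h = M.trans
    (M.reflexive (sum-cong-≗ (λ i → cong f (sym (strictlyInverseʳ (h (from i)))))))
    (M.sym (sum-permute (f ∘ from) π))
    where
    conj : (A → A) → Fin Q → Fin Q
    conj g = to ∘ g ∘ from
    conj-inverse : ∀ g g⁻¹ → (∀ x → g (g⁻¹ x) ≡ x) → ∀ i → conj g (conj g⁻¹ i) ≡ i
    conj-inverse g g⁻¹ g∘g⁻¹ i = begin
      to (g (from (to (g⁻¹ (from i))))) ≡⟨ cong (to ∘ g) (strictlyInverseʳ _) ⟩
      to (g (g⁻¹ (from i)))             ≡⟨ cong to (g∘g⁻¹ _) ⟩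
      to (from i)                       ≡⟨ strictlyInverseˡ i ⟩
      i                                 ∎
      where open ≡-Reasoning
    π : Permutation Q Q
    π = permutation (conj h) (conj h⁻¹) (conj-inverse h h⁻¹ h∘h⁻¹) (conj-inverse h⁻¹ h h⁻¹∘h)

module FiniteField {N : ℕ} (K : GF2 N) where
  open GF2 K
  open IsCommutativeRing isCommutativeRing
    using (+-comm; *-comm; *-assoc; +-identityˡ; +-identityʳ; *-identityˡ; *-identityʳ;
           zeroˡ; zeroʳ; distribˡ; distribʳ)
  open ≡-Reasoning

  ring : CommutativeRing 0ℓ 0ℓ
  ring = record { isCommutativeRing = isCommutativeRing }

  open CommutativeRing ring using (semiring; +-commutativeMonoid; *-commutativeMonoid)
  open import Algebra.Properties.Ring (CommutativeRing.ring ring)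
    using (+-identityʳ-unique; +-inverseʳ-unique; +-cancelʳ; //-rightDividesˡ; //-rightDividesʳ)
  open import Algebra.Properties.Semiring.Mult semiring using (_×_; ×-homo-+; ×1-homo-*)
  import Algebra.Properties.Semiring.Exp semiring as Exp
  import Algebra.Properties.CommutativeSemiring.Exp (CommutativeRing.commutativeSemiring ring) as CExp
  module Σ = MonoidSum +-commutativeMonoid
  module Π = MonoidSum *-commutativeMonoid

  to-injective : Injective _≡_ _≡_ (Inverse.to card)
  to-injective = Injection.injective (↔⇒↣ card)

  _≟_ : (x y : Carrier) → Dec (x ≡ y)
  x ≟ y with Inverse.to card x Fin.≟ Inverse.to card y
  ... | yes tx≡ty = yes (to-injective tx≡ty)
  ... | no tx≢ty = no (tx≢ty ∘ cong (Inverse.to card))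

  *-inverse-cancels : ∀ {u v} → u * v ≡ 1# → ∀ z → u * (v * z) ≡ z
  *-inverse-cancels {u} {v} uv≡1 z = begin
    u * (v * z) ≡⟨ *-assoc u v z ⟨
    u * v * z   ≡⟨ cong (_* z) uv≡1 ⟩
    1# * z      ≡⟨ *-identityˡ z ⟩
    z           ∎

  *-cancelˡ : ∀ {a x y} → a ≢ 0# → a * x ≡ a * y → x ≡ y
  *-cancelˡ {a} {x} {y} a≢0 ax≡ay with a⁻¹ , aa⁻¹≡1 ← inverse a a≢0 = begin
    x               ≡⟨ *-inverse-cancels a⁻¹a≡1 x ⟨
    a⁻¹ * (a * x)   ≡⟨ cong (a⁻¹ *_) ax≡ay ⟩
    a⁻¹ * (a * y)   ≡⟨ *-inverse-cancels a⁻¹a≡1 y ⟩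
    y               ∎
    where
    a⁻¹a≡1 : a⁻¹ * a ≡ 1#
    a⁻¹a≡1 = trans (*-comm a⁻¹ a) aa⁻¹≡1

  *≡0⇒≡0 : ∀ {a b} → a ≢ 0# → a * b ≡ 0# → b ≡ 0#
  *≡0⇒≡0 {a} a≢0 ab≡0 = *-cancelˡ a≢0 (trans ab≡0 (sym (zeroʳ a)))

  *-≢0 : ∀ {a b} → a ≢ 0# → b ≢ 0# → a * b ≢ 0#
  *-≢0 a≢0 b≢0 ab≡0 = b≢0 (*≡0⇒≡0 a≢0 ab≡0)

  ^-≢0 : ∀ {a} → a ≢ 0# → ∀ k → a ^ k ≢ 0#
  ^-≢0 a≢0 zero 1≡0 = 0≢1 (sym 1≡0)
  ^-≢0 a≢0 (suc k) = *-≢0 a≢0 (^-≢0 a≢0 k)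

  Π-≢0 : ∀ {n} (f : Fin n → Carrier) → (∀ i → f i ≢ 0#) → Π.sum f ≢ 0#
  Π-≢0 {zero} f f≢0 1≡0 = 0≢1 (sym 1≡0)
  Π-≢0 {suc n} f f≢0 = *-≢0 (f≢0 Fin.zero) (Π-≢0 (f ∘ Fin.suc) (f≢0 ∘ Fin.suc))

  injective⇒permutation : ∀ {f} → Injective _≡_ _≡_ f → IsPermutation f
  injective⇒permutation {f} f-inj = f-inj , surjective
    where
    open Inverse card
    f̂ : Fin (2 ℕ.^ N) → Fin (2 ℕ.^ N)
    f̂ = to ∘ f ∘ from
    f̂-inj : Injective _≡_ _≡_ f̂
    f̂-inj f̂i≡f̂j = trans (sym (strictlyInverseˡ _))
                  (trans (cong to (f-inj (to-injective f̂i≡f̂j))) (strictlyInverseˡ _))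
    surjective : ∀ y → ∃ λ x → ∀ {z} → z ≡ x → f z ≡ y
    surjective y with i , f̂i≡y ← Fin-injective⇒surjective f̂ f̂-inj (to y)
      = from i , λ { refl → to-injective f̂i≡y }

  ^≡Exp^ : ∀ x k → x ^ k ≡ x Exp.^ k
  ^≡Exp^ x zero = refl
  ^≡Exp^ x (suc k) = cong (x *_) (^≡Exp^ x k)

  ^-assocʳ : ∀ x m n → (x ^ m) ^ n ≡ x ^ (m ℕ.* n)
  ^-assocʳ x m n = trans (^≡Exp^ (x ^ m) n)
    (trans (cong (Exp._^ n) (^≡Exp^ x m)) (trans (Exp.^-assocʳ x m n) (sym (^≡Exp^ x (m ℕ.* n)))))

  ^-distrib-* : ∀ x y n → (x * y) ^ n ≡ x ^ n * y ^ n
  ^-distrib-* x y n = trans (^≡Exp^ (x * y) n)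
    (trans (CExp.^-distrib-* x y n) (sym (cong₂ _*_ (^≡Exp^ x n) (^≡Exp^ y n))))

  -- Translation by 1 permutes the field, so Σ y = Σ (y + 1) = Σ y + Q · 1.
  card×1≡0 : ∀ {Q} → Carrier ↔ Fin Q → Q × 1# ≡ 0#
  card×1≡0 {Q} enum = +-identityʳ-unique (∑ id) (Q × 1#) (begin
    ∑ id + Q × 1#            ≡⟨ cong (∑ id +_) (Σ.sum-replicate Q) ⟨
    ∑ id + ∑ (λ _ → 1#)      ≡⟨ Σ.∑-distrib-+ (Inverse.from enum) (λ _ → 1#) ⟨
    ∑ (_+ 1#)                ≡⟨ ∑-reindex id (_+ 1#) (_+ - 1#) (//-rightDividesˡ 1#) (//-rightDividesʳ 1#) ⟩
    ∑ id                     ∎)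
    where open FiniteSum enum +-commutativeMonoid using (∑; ∑-reindex)

  module Units {Q : ℕ} (enum : Carrier ↔ Fin (suc Q)) where
    open Inverse enum using (to; from; strictlyInverseˡ; strictlyInverseʳ)
    open FiniteSum enum *-commutativeMonoid renaming (∑ to ∏; ∑-reindex to ∏-reindex)

    nonzero : Fin Q → Carrier
    nonzero j = from (Fin.punchIn (to 0#) j)

    nonzero≢0 : ∀ j → nonzero j ≢ 0#
    nonzero≢0 j ≡0 = Finₚ.punchInᵢ≢i (to 0#) j (trans (sym (strictlyInverseˡ _)) (cong to ≡0))

    or1 : Carrier → Carrier
    or1 y with y ≟ 0#
    ... | yes _ = 1#
    ... | no _ = y

    or1-0# : or1 0# ≡ 1#
    or1-0# with 0# ≟ 0#
    ... | yes _ = refl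
    ... | no 0≢0 = ⊥-elim (0≢0 refl)

    or1-≢0 : ∀ {y} → y ≢ 0# → or1 y ≡ y
    or1-≢0 {y} y≢0 with y ≟ 0#
    ... | yes y≡0 = ⊥-elim (y≢0 y≡0)
    ... | no _ = refl

    ∏-or1 : ∀ g → g 0# ≡ 0# → (∀ j → g (nonzero j) ≢ 0#) → ∏ (or1 ∘ g) ≡ Π.sum (g ∘ nonzero)
    ∏-or1 g g0≡0 g≢0 = begin
      ∏ (or1 ∘ g)
        ≡⟨ Π.sum-remove {i = to 0#} (or1 ∘ g ∘ from) ⟩
      or1 (g (from (to 0#))) * Π.sum (or1 ∘ g ∘ nonzero)
        ≡⟨ cong₂ _*_ (cong (or1 ∘ g) (strictlyInverseʳ 0#)) (Π.sum-cong-≗ (or1-≢0 ∘ g≢0)) ⟩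
      or1 (g 0#) * Π.sum (g ∘ nonzero)
        ≡⟨ cong (_* Π.sum (g ∘ nonzero)) (trans (cong or1 g0≡0) or1-0#) ⟩
      1# * Π.sum (g ∘ nonzero)
        ≡⟨ *-identityˡ _ ⟩
      Π.sum (g ∘ nonzero) ∎

    -- y ↦ a y permutes the nonzero elements, so their product P satisfies P = a^Q P
    unit^card : ∀ {a} → a ≢ 0# → a ^ Q ≡ 1#
    unit^card {a} a≢0 with a⁻¹ , aa⁻¹≡1 ← inverse a a≢0 = *-cancelˡ (Π-≢0 nonzero nonzero≢0) (begin
      P * a ^ Q                    ≡⟨ *-comm P (a ^ Q) ⟩
      a ^ Q * P                    ≡⟨ cong (_* P) (trans (^≡Exp^ a Q) (sym (Π.sum-replicate Q {a}))) ⟩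
      Π.sum {Q} (λ _ → a) * P      ≡⟨ Π.∑-distrib-+ {Q} (λ _ → a) nonzero ⟨
      Π.sum (λ j → a * nonzero j)  ≡⟨ ∏-or1 (a *_) (zeroʳ a) (λ j → *-≢0 a≢0 (nonzero≢0 j)) ⟨
      ∏ (or1 ∘ (a *_))             ≡⟨ ∏-reindex or1 (a *_) (a⁻¹ *_) (*-inverse-cancels aa⁻¹≡1)
                                        (*-inverse-cancels (trans (*-comm a⁻¹ a) aa⁻¹≡1)) ⟩
      ∏ or1                        ≡⟨ ∏-or1 id refl nonzero≢0 ⟩
      P                            ≡⟨ *-identityʳ P ⟨
      P * 1#                       ∎)
      where
      P : Carrier
      P = Π.sum nonzero

  fermat : ∀ {Q} → Carrier ↔ Fin Q → ∀ a → a ^ Q ≡ a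
  fermat {zero} enum a with () ← Inverse.to enum a
  fermat {suc Q} enum a with a ≟ 0#
  ... | yes refl = zeroˡ _
  ... | no a≢0 = trans (cong (a *_) (Units.unit^card enum a≢0)) (*-identityʳ a)

  -- Characteristic two

  1+1≡0 : 1# + 1# ≡ 0#
  1+1≡0 with (1# + 1#) ≟ 0#
  ... | yes 2≡0 = 2≡0
  ... | no 2≢0 = ⊥-elim (^-≢0 2≢0 N (begin
    (1# + 1#) ^ N         ≡⟨ cong (_^ N) (cong (1# +_) (+-identityʳ 1#)) ⟨
    (2 × 1#) ^ N          ≡⟨ ^×1 N ⟨
    (2 ℕ.^ N) × 1#        ≡⟨ card×1≡0 card ⟩
    0#                    ∎))
    where
    ^×1 : ∀ k → (2 ℕ.^ k) × 1# ≡ (2 × 1#) ^ k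
    ^×1 zero = +-identityʳ 1#
    ^×1 (suc k) = trans (×1-homo-* 2 (2 ℕ.^ k)) (cong (2 × 1# *_) (^×1 k))

  x+x≡0 : ∀ x → x + x ≡ 0#
  x+x≡0 x = begin
    x + x             ≡⟨ cong₂ _+_ (*-identityˡ x) (*-identityˡ x) ⟨
    1# * x + 1# * x   ≡⟨ distribʳ x 1# 1# ⟨
    (1# + 1#) * x     ≡⟨ cong (_* x) 1+1≡0 ⟩
    0# * x            ≡⟨ zeroˡ x ⟩
    0#                ∎

  -x≡x : ∀ x → - x ≡ x
  -x≡x x = sym (+-inverseʳ-unique x x (x+x≡0 x))

  -- Ring normalisation with coefficients in F₂, so that identities which hold only in
  -- characteristic 2 (such as x + x = 0) are decided as well.
  𝔽₂ : RawRing 0ℓ 0ℓ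
  𝔽₂ = record { Carrier = Bool; _≈_ = _≡_; _+_ = _xor_; _*_ = _∧_; -_ = id; 0# = false; 1# = true }

  ⟦_⟧ : Bool → Carrier
  ⟦ true ⟧ = 1#
  ⟦ false ⟧ = 0#

  𝔽₂⟶K : 𝔽₂ ACR.-Raw-AlmostCommutative⟶ ACR.fromCommutativeRing ring
  𝔽₂⟶K = record
    { ⟦_⟧ = ⟦_⟧
    ; +-homo = λ { false false → sym (+-identityˡ 0#) ; false true → sym (+-identityˡ 1#)
                 ; true false → sym (+-identityʳ 1#) ; true true → sym 1+1≡0 }
    ; *-homo = λ { false false → sym (zeroˡ 0#) ; false true → sym (zeroˡ 1#)
                 ; true false → sym (zeroʳ 1#) ; true true → sym (*-identityˡ 1#) }
    ; -‿homo = λ b → sym (-x≡x ⟦ b ⟧)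
    ; 0-homo = refl
    ; 1-homo = refl }

  ⟦⟧-≟ : ∀ x y → Maybe (⟦ x ⟧ ≡ ⟦ y ⟧)
  ⟦⟧-≟ true true = just refl
  ⟦⟧-≟ false false = just refl
  ⟦⟧-≟ _ _ = nothing

  open import Algebra.Solver.Ring 𝔽₂ (ACR.fromCommutativeRing ring) 𝔽₂⟶K ⟦⟧-≟
    using (solve; _:=_; _:+_; _:*_; con)

  +≡0⇒≡ : ∀ {x y} → x + y ≡ 0# → x ≡ y
  +≡0⇒≡ {x} {y} x+y≡0 = begin
    x           ≡⟨ solve 2 (λ x y → x := (x :+ y) :+ y) refl x y ⟩
    x + y + y   ≡⟨ cong (_+ y) x+y≡0 ⟩
    0# + y      ≡⟨ +-identityˡ y ⟩
    y           ∎

  -- The Frobenius automorphism x ↦ x^(2^e)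

  frob : ℕ → Carrier → Carrier
  frob e x = x ^ (2 ℕ.^ e)

  frob-0 : ∀ x → frob 0 x ≡ x
  frob-0 = *-identityʳ

  frob-suc : ∀ e x → frob (suc e) x ≡ frob e (x * x)
  frob-suc e x = begin
    x ^ (2 ℕ.* 2 ℕ.^ e)      ≡⟨ ^-assocʳ x 2 (2 ℕ.^ e) ⟨
    (x ^ 2) ^ (2 ℕ.^ e)      ≡⟨ cong (λ y → (x * y) ^ (2 ℕ.^ e)) (*-identityʳ x) ⟩
    frob e (x * x)           ∎

  frob-1 : ∀ x → frob 1 x ≡ x * x
  frob-1 x = trans (frob-suc 0 x) (frob-0 (x * x))

  frob-∘ : ∀ e f x → frob (e ℕ.+ f) x ≡ frob e (frob f x)
  frob-∘ e f x = begin
    x ^ (2 ℕ.^ (e ℕ.+ f))          ≡⟨ cong (x ^_) (trans (ℕₚ.^-distribˡ-+-* 2 e f) (ℕₚ.*-comm (2 ℕ.^ e) _)) ⟩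
    x ^ (2 ℕ.^ f ℕ.* 2 ℕ.^ e)      ≡⟨ ^-assocʳ x (2 ℕ.^ f) (2 ℕ.^ e) ⟨
    frob e (frob f x)              ∎

  frob-comm : ∀ e f x → frob e (frob f x) ≡ frob f (frob e x)
  frob-comm e f x = trans (sym (frob-∘ e f x)) (trans (cong (λ k → frob k x) (ℕₚ.+-comm e f)) (frob-∘ f e x))

  frob-+ : ∀ e x y → frob e (x + y) ≡ frob e x + frob e y
  frob-+ zero x y = trans (frob-0 _) (sym (cong₂ _+_ (frob-0 x) (frob-0 y)))
  frob-+ (suc e) x y = begin
    frob (suc e) (x + y)                 ≡⟨ frob-suc e _ ⟩
    frob e ((x + y) * (x + y))           ≡⟨ cong (frob e) (solve 2 (λ x y → (x :+ y) :* (x :+ y)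
                                                                         := x :* x :+ y :* y) refl x y) ⟩
    frob e (x * x + y * y)               ≡⟨ frob-+ e _ _ ⟩
    frob e (x * x) + frob e (y * y)      ≡⟨ cong₂ _+_ (frob-suc e x) (frob-suc e y) ⟨
    frob (suc e) x + frob (suc e) y      ∎

  frob-* : ∀ e x y → frob e (x * y) ≡ frob e x * frob e y
  frob-* e x y = ^-distrib-* x y (2 ℕ.^ e)

  frob-0# : ∀ e → frob e 0# ≡ 0#
  frob-0# zero = zeroˡ 1#
  frob-0# (suc e) = trans (frob-suc e 0#) (trans (cong (frob e) (zeroˡ 0#)) (frob-0# e))

  frob-N : ∀ x → frob N x ≡ x
  frob-N = fermat card

  In-*ˡ : ∀ {e b} t → In e b → In (t ℕ.* e) b
  In-*ˡ zero b∈ = frob-0 _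
  In-*ˡ {e} {b} (suc t) b∈ = trans (frob-∘ e (t ℕ.* e) b) (trans (cong (frob e) (In-*ˡ t b∈)) b∈)

  In-∣ : ∀ {e f b} → e ∣ f → In e b → In f b
  In-∣ (divides q refl) = In-*ˡ q

  In-+ : ∀ {e a b} → In e a → In e b → In e (a + b)
  In-+ {e} {a} {b} a∈ b∈ = trans (frob-+ e a b) (cong₂ _+_ a∈ b∈)

  In-* : ∀ {e a b} → In e a → In e b → In e (a * b)
  In-* {e} {a} {b} a∈ b∈ = trans (frob-* e a b) (cong₂ _*_ a∈ b∈)

  1^k≡1 : ∀ k → 1# ^ k ≡ 1#
  1^k≡1 zero = refl
  1^k≡1 (suc k) = trans (*-identityˡ _) (1^k≡1 k)

  In-1 : ∀ e → In e 1#
  In-1 e = 1^k≡1 (2 ℕ.^ e)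

  Σ<-cong : ∀ k {f g} → (∀ i → f i ≡ g i) → Σ< k f ≡ Σ< k g
  Σ<-cong zero f≗g = refl
  Σ<-cong (suc k) f≗g = cong₂ _+_ (Σ<-cong k f≗g) (f≗g k)

  Σ<-hom : ∀ (h : Carrier → Carrier) → (∀ x y → h (x + y) ≡ h x + h y) → h 0# ≡ 0# →
           ∀ k f → h (Σ< k f) ≡ Σ< k (h ∘ f)
  Σ<-hom h h-+ h-0 zero f = h-0
  Σ<-hom h h-+ h-0 (suc k) f = trans (h-+ _ _) (cong (_+ h (f k)) (Σ<-hom h h-+ h-0 k f))

  Σ<-+ : ∀ k f g → Σ< k (λ i → f i + g i) ≡ Σ< k f + Σ< k g
  Σ<-+ zero f g = sym (+-identityˡ 0#)
  Σ<-+ (suc k) f g = trans (cong (_+ (f k + g k)) (Σ<-+ k f g))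
    (solve 4 (λ a b c d → (a :+ b) :+ (c :+ d) := (a :+ c) :+ (b :+ d)) refl (Σ< k f) (Σ< k g) (f k) (g k))

  Σ<-rotate : ∀ k f → Σ< k (f ∘ suc) + f 0 ≡ Σ< k f + f k
  Σ<-rotate zero f = refl
  Σ<-rotate (suc k) f = begin
    Σ< k (f ∘ suc) + f (suc k) + f 0   ≡⟨ solve 3 (λ a b c → a :+ b :+ c := a :+ c :+ b) refl
                                                   (Σ< k (f ∘ suc)) (f (suc k)) (f 0) ⟩
    Σ< k (f ∘ suc) + f 0 + f (suc k)   ≡⟨ cong (_+ f (suc k)) (Σ<-rotate k f) ⟩
    Σ< k f + f k + f (suc k)           ∎

  Σ<-const : ∀ k c → Σ< k (λ _ → c) ≡ k × c
  Σ<-const zero c = refl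
  Σ<-const (suc k) c = trans (cong (_+ c) (Σ<-const k c)) (+-comm _ c)

  odd×x≡x : ∀ {M} → IsOdd M → ∀ x → M × x ≡ x
  odd×x≡x (k , refl) x = begin
    x + (k ℕ.+ (k ℕ.+ 0)) × x    ≡⟨ cong (x +_) (×-homo-+ x k (k ℕ.+ 0)) ⟩
    x + (k × x + (k ℕ.+ 0) × x)  ≡⟨ cong (λ j → x + (k × x + j × x)) (ℕₚ.+-identityʳ k) ⟩
    x + (k × x + k × x)          ≡⟨ cong (x +_) (x+x≡0 (k × x)) ⟩
    x + 0#                       ≡⟨ +-identityʳ x ⟩
    x                            ∎

  Σ<-odd-const : ∀ {M} → IsOdd M → ∀ x → Σ< M (λ _ → x) ≡ x
  Σ<-odd-const {M} M-odd x = trans (Σ<-const M x) (odd×x≡x M-odd x)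

  ΣF≡sum : ∀ k f → ΣF k f ≡ Σ.sum f
  ΣF≡sum zero f = refl
  ΣF≡sum (suc k) f = cong (f Fin.zero +_) (ΣF≡sum k (f ∘ Fin.suc))

  ΣF-cong : ∀ k {f g} → (∀ i → f i ≡ g i) → ΣF k f ≡ ΣF k g
  ΣF-cong k {f} {g} f≗g = trans (ΣF≡sum k f) (trans (Σ.sum-cong-≗ f≗g) (sym (ΣF≡sum k g)))

  ΣF-init-last : ∀ k f → ΣF (suc k) f ≡ ΣF k (f ∘ Fin.inject₁) + f (Fin.fromℕ k)
  ΣF-init-last k f = trans (ΣF≡sum (suc k) f)
    (trans (Σ.sum-init-last f) (cong (_+ _) (sym (ΣF≡sum k (f ∘ Fin.inject₁)))))

  ΣF-0 : ∀ k → ΣF k (λ _ → 0#) ≡ 0#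
  ΣF-0 k = trans (ΣF≡sum k _) (Σ.sum-replicate-zero k)

  ΣF-In : ∀ {e} k (f : Fin k → Carrier) → (∀ i → In e (f i)) → In e (ΣF k f)
  ΣF-In {e} zero f f∈ = frob-0# e
  ΣF-In {e} (suc k) f f∈ = In-+ {e} (f∈ Fin.zero) (ΣF-In {e} k (f ∘ Fin.suc) (f∈ ∘ Fin.suc))

  -- Traces onto subfields of odd degree

  record OddDegreeSubfield (e : ℕ) : Set where
    field
      degree      : ℕ
      1≤e         : 1 ≤ e
      N≡e*degree  : N ≡ e ℕ.* degree
      degree-odd  : IsOdd degree

  module Trace {e} (L : OddDegreeSubfield e) where
    open OddDegreeSubfield L

    T : Carrier → Carrier
    T = tr e N

    tr-unfold : ∀ x → T x ≡ Σ< degree (λ i → frob (e ℕ.* i) x)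
    tr-unfold x = cong (λ k → Σ< k (λ i → frob (e ℕ.* i) x)) (N÷e 1≤e N≡e*degree)
      where
      N÷e : ∀ {e′} → 1 ≤ e′ → N ≡ e′ ℕ.* degree → N ÷ e′ ≡ degree
      N÷e {suc e′} _ N≡ = trans (cong (ℕ._/ suc e′) (trans N≡ (ℕₚ.*-comm (suc e′) degree)))
                                (m*n/n≡m degree (suc e′))

    tr-+ : ∀ x y → T (x + y) ≡ T x + T y
    tr-+ x y = begin
      T (x + y)                                              ≡⟨ tr-unfold _ ⟩
      Σ< degree (λ i → frob (e ℕ.* i) (x + y))                ≡⟨ Σ<-cong degree (λ i → frob-+ (e ℕ.* i) x y) ⟩
      Σ< degree (λ i → frob (e ℕ.* i) x + frob (e ℕ.* i) y)   ≡⟨ Σ<-+ degree _ _ ⟩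
      Σ< degree (λ i → frob (e ℕ.* i) x)
        + Σ< degree (λ i → frob (e ℕ.* i) y)                 ≡⟨ cong₂ _+_ (tr-unfold x) (tr-unfold y) ⟨
      T x + T y                                              ∎

    frob-fixes : ∀ {b} → In e b → ∀ i → frob (e ℕ.* i) b ≡ b
    frob-fixes {b} b∈ i = trans (cong (λ k → frob k b) (ℕₚ.*-comm e i)) (In-*ˡ i b∈)

    tr-*ˡ : ∀ {b} x → In e b → T (b * x) ≡ b * T x
    tr-*ˡ {b} x b∈ = begin
      T (b * x)                                      ≡⟨ tr-unfold _ ⟩
      Σ< degree (λ i → frob (e ℕ.* i) (b * x))        ≡⟨ Σ<-cong degree (λ i → trans (frob-* (e ℕ.* i) b x)
                                                            (cong (_* frob (e ℕ.* i) x) (frob-fixes b∈ i))) ⟩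
      Σ< degree (λ i → b * frob (e ℕ.* i) x)          ≡⟨ Σ<-hom (b *_) (distribˡ b) (zeroʳ b) degree _ ⟨
      b * Σ< degree (λ i → frob (e ℕ.* i) x)          ≡⟨ cong (b *_) (tr-unfold x) ⟨
      b * T x                                        ∎

    tr-0# : T 0# ≡ 0#
    tr-0# = trans (cong T (sym (zeroˡ 0#))) (trans (tr-*ˡ 0# (frob-0# e)) (zeroˡ _))

    tr-frob : ∀ j x → frob j (T x) ≡ T (frob j x)
    tr-frob j x = begin
      frob j (T x)                                        ≡⟨ cong (frob j) (tr-unfold x) ⟩
      frob j (Σ< degree (λ i → frob (e ℕ.* i) x))          ≡⟨ Σ<-hom (frob j) (frob-+ j) (frob-0# j) degree _ ⟩
      Σ< degree (λ i → frob j (frob (e ℕ.* i) x))          ≡⟨ Σ<-cong degree (λ i → frob-comm j (e ℕ.* i) x) ⟩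
      Σ< degree (λ i → frob (e ℕ.* i) (frob j x))          ≡⟨ tr-unfold _ ⟨
      T (frob j x)                                        ∎

    -- frob e permutes the conjugates cyclically, since frob (e * degree) = frob N = id
    tr-frob-invariant : ∀ x → T (frob e x) ≡ T x
    tr-frob-invariant x = begin
      T (frob e x)                                   ≡⟨ tr-unfold _ ⟩
      Σ< degree (λ i → frob (e ℕ.* i) (frob e x))    ≡⟨ Σ<-cong degree frob-shift ⟩
      Σ< degree (conj ∘ suc)                         ≡⟨ +-cancelʳ (conj 0) _ _ (begin
         Σ< degree (conj ∘ suc) + conj 0             ≡⟨ Σ<-rotate degree conj ⟩
         Σ< degree conj + conj degree                ≡⟨ cong (Σ< degree conj +_) (trans conj-degree (sym conj-0)) ⟩
         Σ< degree conj + conj 0                     ∎) ⟩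
      Σ< degree conj                                 ≡⟨ tr-unfold x ⟨
      T x                                            ∎
      where
      conj : ℕ → Carrier
      conj i = frob (e ℕ.* i) x
      frob-shift : ∀ i → frob (e ℕ.* i) (frob e x) ≡ conj (suc i)
      frob-shift i = trans (frob-comm (e ℕ.* i) e x)
        (trans (sym (frob-∘ e (e ℕ.* i) x)) (cong (λ k → frob k x) (sym (ℕₚ.*-suc e i))))
      conj-0 : conj 0 ≡ x
      conj-0 = trans (cong (λ k → frob k x) (ℕₚ.*-zeroʳ e)) (frob-0 x)
      conj-degree : conj degree ≡ x
      conj-degree = trans (cong (λ k → frob k x) (sym N≡e*degree)) (frob-N x)

    tr-frob-multiple-invariant : ∀ t x → T (frob (t ℕ.* e) x) ≡ T x
    tr-frob-multiple-invariant zero x = cong T (frob-0 x)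
    tr-frob-multiple-invariant (suc t) x =
      trans (cong T (frob-∘ e (t ℕ.* e) x)) (trans (tr-frob-invariant _) (tr-frob-multiple-invariant t x))

    tr-In : ∀ x → In e (T x)
    tr-In x = trans (tr-frob e x) (tr-frob-invariant x)

    tr-fixes : ∀ {b} → In e b → T b ≡ b
    tr-fixes {b} b∈ = begin
      T b                                  ≡⟨ tr-unfold b ⟩
      Σ< degree (λ i → frob (e ℕ.* i) b)    ≡⟨ Σ<-cong degree (frob-fixes b∈) ⟩
      Σ< degree (λ _ → b)                   ≡⟨ Σ<-odd-const degree-odd b ⟩
      b                                     ∎

    tr-idem : ∀ x → T (T x) ≡ T x
    tr-idem x = tr-fixes (tr-In x)

    tr-sq : ∀ x → T (x * x) ≡ T x * T x
    tr-sq x = begin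
      T (x * x)         ≡⟨ cong T (frob-1 x) ⟨
      T (frob 1 x)      ≡⟨ tr-frob 1 x ⟨
      frob 1 (T x)      ≡⟨ frob-1 (T x) ⟩
      T x * T x         ∎

  tr-tower : ∀ {e e′} → OddDegreeSubfield e → OddDegreeSubfield e′ → e′ ∣ e →
             ∀ x → tr e′ N (tr e N x) ≡ tr e′ N x
  tr-tower {e} {e′} L L′ (divides q e≡qe′) x = begin
    T′ (T x)                                           ≡⟨ cong T′ (Tr.tr-unfold x) ⟩
    T′ (Σ< degree (λ i → frob (e ℕ.* i) x))             ≡⟨ Σ<-hom T′ Tr′.tr-+ Tr′.tr-0# degree _ ⟩
    Σ< degree (λ i → T′ (frob (e ℕ.* i) x))             ≡⟨ Σ<-cong degree conj-invariant ⟩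
    Σ< degree (λ _ → T′ x)                              ≡⟨ Σ<-odd-const degree-odd (T′ x) ⟩
    T′ x                                               ∎
    where
    module Tr = Trace L
    module Tr′ = Trace L′
    open OddDegreeSubfield L using (degree; degree-odd)
    T T′ : Carrier → Carrier
    T = Tr.T
    T′ = Tr′.T
    conj-invariant : ∀ i → T′ (frob (e ℕ.* i) x) ≡ T′ x
    conj-invariant i = trans
      (cong (λ k → T′ (frob k x)) (trans (cong (ℕ._* i) e≡qe′)
        (trans (ℕₚ.*-comm (q ℕ.* e′) i) (sym (ℕₚ.*-assoc i q e′)))))
      (Tr′.tr-frob-multiple-invariant (i ℕ.* q) x)

  record IsOddTower {k} (e : Fin k → ℕ) : Set where
    field
      subfield : ∀ i → OddDegreeSubfield (e i)
      chain    : ∀ i j → i ≤ᶠ j → e i ∣ e j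

  IsOddTower-init : ∀ {k} {e : Fin (suc k) → ℕ} → IsOddTower e → IsOddTower (e ∘ Fin.inject₁)
  IsOddTower-init tower = record
    { subfield = subfield ∘ Fin.inject₁
    ; chain = λ i j i≤j → chain _ _
        (subst₂ ℕ._≤_ (sym (Finₚ.toℕ-inject₁ i)) (sym (Finₚ.toℕ-inject₁ j)) i≤j) }
    where open IsOddTower tower

  tracePoly : ∀ {k} → (Fin k → ℕ) → (Fin k → Carrier) → Carrier → Carrier → Carrier
  tracePoly {k} e a c x = x * (ΣF k (λ i → a i * tr (e i) N x) + ΣF k a * x) + c * x

  tracePoly-0# : ∀ {k} e a c → tracePoly {k} e a c 0# ≡ 0#
  tracePoly-0# {k} e a c =
    solve 3 (λ s C c → con false :* (s :+ C :* con false) :+ c :* con false := con false) refl _ _ c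

  tracePoly-+1 : ∀ {k} e a c x → tracePoly {k} e a (c + 1#) x ≡ tracePoly e a c x + x
  tracePoly-+1 {k} e a c x =
    solve 3 (λ x p c → x :* p :+ (c :+ con true) :* x := x :* p :+ c :* x :+ x) refl x _ c

  module TopTrace {k} {e : Fin (suc k) → ℕ} (tower : IsOddTower e)
                  (a : Fin (suc k) → Carrier) (a∈ : ∀ i → In (e i) (a i))
                  {c : Carrier} (c∈ : ∀ i → In (e i) c) where
    open IsOddTower tower
    top : Fin (suc k)
    top = Fin.fromℕ k
    E : ℕ
    E = e top
    open Trace (subfield top) using (T; tr-+; tr-*ˡ; tr-In; tr-idem; tr-sq; tr-fixes; tr-0#)

    S : Carrier → Carrier
    S x = ΣF (suc k) (λ i → a i * tr (e i) N x)

    C : Carrier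
    C = ΣF (suc k) a

    F F′ : Carrier → Carrier
    F = tracePoly e a c
    F′ = tracePoly (e ∘ Fin.inject₁) (a ∘ Fin.inject₁) c

    e∣E : ∀ i → e i ∣ E
    e∣E i = chain i top (Finₚ.≤fromℕ i)

    S-In : ∀ x → In E (S x)
    S-In x = ΣF-In {E} (suc k) _
      (λ i → In-* {E} (In-∣ (e∣E i) (a∈ i)) (In-∣ (e∣E i) (Trace.tr-In (subfield i) x)))

    C-In : In E C
    C-In = ΣF-In {E} (suc k) a (λ i → In-∣ (e∣E i) (a∈ i))

    S∘T : ∀ x → S (T x) ≡ S x
    S∘T x = ΣF-cong (suc k) (λ i → cong (a i *_) (tr-tower (subfield top) (subfield i) (e∣E i) x))

    S-0# : S 0# ≡ 0#
    S-0# = trans (ΣF-cong (suc k) (λ i → trans (cong (a i *_) (Trace.tr-0# (subfield i))) (zeroʳ _)))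
                 (ΣF-0 (suc k))

    T∘F : ∀ x → T (F x) ≡ S x * T x + C * (T x * T x) + c * T x
    T∘F x = begin
      T (x * (S x + C * x) + c * x)
        ≡⟨ cong T (solve 4 (λ x s C c → x :* (s :+ C :* x) :+ c :* x
                                      := s :* x :+ C :* (x :* x) :+ c :* x) refl x (S x) C c) ⟩
      T (S x * x + C * (x * x) + c * x)
        ≡⟨ trans (tr-+ _ _) (cong (_+ T (c * x)) (tr-+ _ _)) ⟩
      T (S x * x) + T (C * (x * x)) + T (c * x)
        ≡⟨ cong₂ _+_ (cong₂ _+_ (tr-*ˡ x (S-In x)) (trans (tr-*ˡ _ C-In) (cong (C *_) (tr-sq x))))
                     (tr-*ˡ x (c∈ top)) ⟩
      S x * T x + C * (T x * T x) + c * T x ∎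

    -- a_top (T x)² occurs twice, once from S (T x) and once from C
    F′∘T : ∀ x → S x * T x + C * (T x * T x) + c * T x ≡ F′ (T x)
    F′∘T x = begin
      S x * w + C * (w * w) + c * w
        ≡⟨ cong₂ (λ u v → u * w + v * (w * w) + c * w) S-split (ΣF-init-last k a) ⟩
      (S′ + aₜ * w) * w + (C′ + aₜ) * (w * w) + c * w
        ≡⟨ solve 5 (λ s a w C c → (s :+ a :* w) :* w :+ (C :+ a) :* (w :* w) :+ c :* w
                                := w :* (s :+ C :* w) :+ c :* w) refl S′ aₜ w C′ c ⟩
      F′ w ∎
      where
      w aₜ S′ C′ : Carrier
      w = T x
      aₜ = a top
      S′ = ΣF k (λ i → a (Fin.inject₁ i) * tr (e (Fin.inject₁ i)) N w)
      C′ = ΣF k (a ∘ Fin.inject₁)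
      S-split : S x ≡ S′ + aₜ * w
      S-split = begin
        S x                                    ≡⟨ S∘T x ⟨
        S w                                    ≡⟨ ΣF-init-last k (λ i → a i * tr (e i) N w) ⟩
        S′ + aₜ * T w                          ≡⟨ cong (λ t → S′ + aₜ * t) (tr-idem x) ⟩
        S′ + aₜ * w                            ∎

    F+F : ∀ {x y} → S x ≡ S y → F x + F y ≡ (x + y) * (S x + c + C * (x + y))
    F+F {x} {y} Sx≡Sy = begin
      F x + F y
        ≡⟨ cong (λ s → F x + (y * (s + C * y) + c * y)) Sx≡Sy ⟨
      x * (S x + C * x) + c * x + (y * (S x + C * y) + c * y)
        ≡⟨ solve 5 (λ x y s c C → x :* (s :+ C :* x) :+ c :* x :+ (y :* (s :+ C :* y) :+ c :* y)
                                := (x :+ y) :* (s :+ c :+ C :* (x :+ y))) refl x y (S x) c C ⟩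
      (x + y) * (S x + c + C * (x + y)) ∎

    c≡0 : Injective _≡_ _≡_ F′ → ∀ {x z} → z ≢ 0# → T z ≡ 0# → S x + c + C * z ≡ 0# → c ≡ 0#
    c≡0 F′-inj {x} {z} z≢0 Tz≡0 B≡0 = begin
      c             ≡⟨ +≡0⇒≡ (trans (+-comm c (S x)) Sx+c≡0) ⟩
      S x           ≡⟨ S∘T x ⟨
      S (T x)       ≡⟨ cong S Tx≡0 ⟩
      S 0#          ≡⟨ S-0# ⟩
      0#            ∎
      where
      Sx+c≡0 : S x + c ≡ 0#
      Sx+c≡0 = begin
        S x + c                       ≡⟨ tr-fixes (In-+ {E} (S-In x) (c∈ top)) ⟨
        T (S x + c)                   ≡⟨ +-identityʳ _ ⟨
        T (S x + c) + 0#              ≡⟨ cong (T (S x + c) +_) (trans (cong (C *_) Tz≡0) (zeroʳ C)) ⟨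
        T (S x + c) + C * T z         ≡⟨ trans (tr-+ _ _) (cong (T (S x + c) +_) (tr-*ˡ z C-In)) ⟨
        T (S x + c + C * z)           ≡⟨ cong T B≡0 ⟩
        T 0#                          ≡⟨ tr-0# ⟩
        0#                            ∎
      C≡0 : C ≡ 0#
      C≡0 = *≡0⇒≡0 z≢0 (trans (*-comm z C)
              (trans (sym (+-identityˡ _)) (trans (cong (_+ C * z) (sym Sx+c≡0)) B≡0)))
      Tx≡0 : T x ≡ 0#
      Tx≡0 = F′-inj (begin
        F′ (T x)                                            ≡⟨ F′∘T x ⟨
        S x * T x + C * (T x * T x) + c * T x
          ≡⟨ solve 4 (λ s C c w → s :* w :+ C :* (w :* w) :+ c :* w
                                := (s :+ c) :* w :+ C :* (w :* w)) refl (S x) C c (T x) ⟩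
        (S x + c) * T x + C * (T x * T x)
          ≡⟨ cong₂ (λ u v → u * T x + v * (T x * T x)) Sx+c≡0 C≡0 ⟩
        0# * T x + 0# * (T x * T x)
          ≡⟨ solve 1 (λ w → con false :* w :+ con false :* (w :* w) := con false) refl (T x) ⟩
        0#
          ≡⟨ tracePoly-0# (e ∘ Fin.inject₁) (a ∘ Fin.inject₁) c ⟨
        F′ 0# ∎)

    injective : c ≢ 0# → Injective _≡_ _≡_ F′ → Injective _≡_ _≡_ F
    injective c≢0 F′-inj {x} {y} Fx≡Fy with (x + y) ≟ 0#
    ... | yes x+y≡0 = +≡0⇒≡ x+y≡0
    ... | no x+y≢0 = ⊥-elim (c≢0 (c≡0 F′-inj x+y≢0 Tz≡0 B≡0))
      where
      Tx≡Ty : T x ≡ T y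
      Tx≡Ty = F′-inj (begin
        F′ (T x)   ≡⟨ trans (T∘F x) (F′∘T x) ⟨
        T (F x)    ≡⟨ cong T Fx≡Fy ⟩
        T (F y)    ≡⟨ trans (T∘F y) (F′∘T y) ⟩
        F′ (T y)   ∎)
      Tz≡0 : T (x + y) ≡ 0#
      Tz≡0 = trans (tr-+ x y) (trans (cong (T x +_) (sym Tx≡Ty)) (x+x≡0 _))
      Sx≡Sy : S x ≡ S y
      Sx≡Sy = trans (sym (S∘T x)) (trans (cong S Tx≡Ty) (S∘T y))
      B≡0 : S x + c + C * (x + y) ≡ 0#
      B≡0 = *≡0⇒≡0 x+y≢0 (trans (sym (F+F Sx≡Sy)) (trans (cong (_+ F y) Fx≡Fy) (x+x≡0 _)))

  tracePoly-injective : ∀ {k} {e : Fin k → ℕ} → IsOddTower e →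
                        ∀ a → (∀ i → In (e i) (a i)) → ∀ {c} → (∀ i → In (e i) c) → c ≢ 0# →
                        Injective _≡_ _≡_ (tracePoly e a c)
  tracePoly-injective {zero} _ _ _ {c} _ c≢0 {x} {y} Fx≡Fy =
    *-cancelˡ c≢0 (trans (sym (linear x)) (trans Fx≡Fy (linear y)))
    where
    linear : ∀ x → x * (0# + 0# * x) + c * x ≡ c * x
    linear x = solve 2 (λ x c → x :* (con false :+ con false :* x) :+ c :* x := c :* x) refl x c
  tracePoly-injective {suc k} tower a a∈ c∈ c≢0 =
    TopTrace.injective tower a a∈ c∈ c≢0
      (tracePoly-injective (IsOddTower-init tower) (a ∘ Fin.inject₁) (a∈ ∘ Fin.inject₁)
                           (c∈ ∘ Fin.inject₁) c≢0)

  scaledDegrees : ∀ {s} → ℕ → (Fin s → ℕ) → Fin (suc s) → ℕ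
  scaledDegrees m d = m ∷ (λ i → d i ℕ.* m)

  scaled-tower : ∀ {s} m n → N ≡ n ℕ.* m → 1 ≤ m → IsOdd n → (d : Fin s → ℕ) →
                 (∀ i → 1 ≤ d i) → (∀ i j → i ≤ᶠ j → d i ∣ d j) → (∀ i → d i ∣ n) →
                 IsOddTower (scaledDegrees m d)
  scaled-tower m n N≡nm 1≤m n-odd d 1≤d d-chain d∣n = record { subfield = subfield ; chain = chain }
    where
    subfield : ∀ i → OddDegreeSubfield (scaledDegrees m d i)
    subfield Fin.zero = record
      { degree = n ; 1≤e = 1≤m ; N≡e*degree = trans N≡nm (ℕₚ.*-comm n m) ; degree-odd = n-odd }
    subfield (Fin.suc i) with divides q n≡qd ← d∣n i = record
      { degree = q
      ; 1≤e = ℕₚ.*-mono-≤ (1≤d i) 1≤m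
      ; N≡e*degree = trans N≡nm (trans (cong (ℕ._* m) n≡qd)
          (trans (ℕₚ.*-assoc q (d i) m) (ℕₚ.*-comm q (d i ℕ.* m))))
      ; degree-odd = IsOdd-*ˡ q (d i) (subst IsOdd n≡qd n-odd) }
    chain : ∀ i j → i ≤ᶠ j → scaledDegrees m d i ∣ scaledDegrees m d j
    chain Fin.zero Fin.zero _ = ∣-refl
    chain Fin.zero (Fin.suc j) _ = n∣m*n (d j)
    chain (Fin.suc i) (Fin.suc j) i≤j = *-monoˡ-∣ m (d-chain i j (ℕ.s≤s⁻¹ i≤j))

  scaled-In : ∀ {s m t} (d : Fin s → ℕ) → In m t → ∀ i → In (scaledDegrees m d i) t
  scaled-In d t∈ Fin.zero = t∈
  scaled-In d t∈ (Fin.suc i) = In-∣ (n∣m*n (d i)) t∈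

corollary5 : (m n : ℕ) → 1 ≤ m → 1 ≤ n → IsOdd n →
    (K : GF2 (n ℕ.* m)) →
    (s : ℕ) → 1 ≤ s → (d : Fin s → ℕ) →
    (∀ i → 1 ≤ d i) → Injective _≡_ _≡_ d →
    (∀ i j → i ≤ᶠ j → d i ∣ d j) → (∀ i → d i ∣ n) →
    let open GF2 K in
    (c₀ : Carrier) → In m c₀ →
    (c : Fin s → Carrier) → (∀ i → In (d i ℕ.* m) (c i)) →
    (c~ : Carrier) → In m c~ → c~ ≢ 0# → c~ ≢ 1# →
    let csum = c₀ + ΣF s c in
    IsCompletePermutation
      (λ x → x * (c₀ * tr m (n ℕ.* m) x
                   + ΣF s (λ i → c i * tr (d i ℕ.* m) (n ℕ.* m) x)
                   + csum * x)
             + c~ * x)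
corollary5 m n 1≤m _ n-odd K s _ d 1≤d _ d-chain d∣n c₀ c₀∈ c c∈ c~ c~∈ c~≢0 c~≢1 =
    injective⇒permutation (injective c~∈ c~≢0)
  , injective⇒permutation (λ {x} {y} Fx+x≡Fy+y → injective (In-+ {m} c~∈ (In-1 m)) (c~≢1 ∘ +≡0⇒≡)
      (trans (tracePoly-+1 e a c~ x) (trans Fx+x≡Fy+y (sym (tracePoly-+1 e a c~ y)))))
  where
  open GF2 K
  open FiniteField K
  e : Fin (suc s) → ℕ
  e = scaledDegrees m d
  a : Fin (suc s) → Carrier
  a = c₀ ∷ c
  a∈ : ∀ i → In (e i) (a i)
  a∈ Fin.zero = c₀∈
  a∈ (Fin.suc i) = c∈ i
  injective : ∀ {t} → In m t → t ≢ 0# → Injective _≡_ _≡_ (tracePoly e a t)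
  injective t∈ = tracePoly-injective (scaled-tower m n refl 1≤m n-odd d 1≤d d-chain d∣n) a a∈
                                     (scaled-In d t∈)
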